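{- Let $r\ge2$, let $s_1,\dots,s_r$ be independent indeterminates over $\mathbb{Q}$, put $s_0=1$ and $s_i=0$ for $i<0$ or $i>r$, and $f(x)=x^r+s_1x^{r-1}+\cdots+s_r$. Define $(r-1)\times(r-1)$ matrices $T_1,T_2,T_3,T_4$ by, for $1\le i,j\le r-1$: $(T_1)_{i,j}=(j-i)\,s_{r-(j-i)}$ if $j\ge i$ and $0$ otherwise; $(T_2)_{i,j}=s_{i-j}$; $(T_3)_{i,j}=s_{r-(j-i)}$ if $j\ge i$ and $0$ otherwise; $(T_4)_{i,j}=(r-(i-j))\,s_{i-j}$ if $i\ge j$ and $0$ otherwise. Let $u$ be the column vector with entries $u_i=(r-i)s_i$ and $v$ the row vector with entries $v_j=(r-j)s_{r-j}$ ($1\le i,j\le r-1$). Then \[ -T_1T_2+T_3T_4-\frac1r\,u\,v=B_r, \] where $B_r=J_{r-1}\,\mathrm{Bez}\big(f'(x),\,f(x)-\tfrac1r xf'(x)\big)$.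
   Context: For polynomials $F,G$ with $m=\max(\deg F,\deg G)$, the Bézout matrix $\mathrm{Bez}(F,G)$ is the $m\times m$ matrix determined by $\frac{F(x)G(y)-F(y)G(x)}{x-y}=(1,x,\dots,x^{m-1})\,\mathrm{Bez}(F,G)\,(1,y,\dots,y^{m-1})^T$ (here $m=r-1$). $J_{r-1}$ is the $(r-1)\times(r-1)$ matrix with ones on the anti-diagonal and zeros elsewhere. -}

module Defs where

open import Level using (Level)
open import Data.Nat using (ℕ; zero; suc; _∸_; _≤_; _<_; _≤?_; _<?_; _≟_) renaming (_+_ to _+ℕ_)
open import Data.Fin using (Fin; fromℕ<)
open import Relation.Nullary using (yes; no)
open import Algebra.Bundles using (CommutativeRing)

module _ {c ℓ : Level} (R : CommutativeRing c ℓ) where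
  open CommutativeRing R

  ι : ℕ → Carrier
  ι zero    = 0#
  ι (suc n) = 1# + ι n

  ∑ : ℕ → ℕ → (ℕ → Carrier) → Carrier
  ∑ a zero    f = 0#
  ∑ a (suc n) f = f a + ∑ (suc a) n f

  -- matrices with entries indexed by ℕ × ℕ (only a finite block is used)
  Mat : Set c
  Mat = ℕ → ℕ → Carrier

  _⊗[_]_ : Mat → ℕ → Mat → Mat
  (A ⊗[ n ] B) i j = ∑ 1 n (λ k → A i k * B k j)

  J : ℕ → Mat
  J n i j with i +ℕ j ≟ suc n
  ... | yes _ = 1#
  ... | no  _ = 0#

  -- polynomials as coefficient sequences: p k = coefficient of x^k
  Poly : Set c
  Poly = ℕ → Carrier

  deriv : Poly → Poly
  deriv p k = ι (suc k) * p (suc k)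

  mulX : Poly → Poly
  mulX p zero    = 0#
  mulX p (suc k) = p k

  _-ₚ_ : Poly → Poly → Poly
  (p -ₚ q) k = p k - q k

  _·ₚ_ : Carrier → Poly → Poly
  (a ·ₚ p) k = a * p k

  [_≤_<_] : ℕ → ℕ → ℕ → Carrier
  [ a ≤ i < b ] with a ≤? i | i <? b
  ... | yes _ | yes _ = 1#
  ... | _     | _     = 0#

  -- Bézout matrix (0-indexed, m×m, entries i,j ∈ {0..m-1}) of polynomials of
  -- degree ≤ m: the coefficient of x^i y^j in (F(x)G(y) - F(y)G(x))/(x - y).
  -- Since (x^k y^l - x^l y^k)/(x - y) = Σ_{l ≤ i < k} x^i y^{k+l-1-i} for l < k,
  -- this coefficient is
  --   Σ_{k,l ≤ m, k+l = i+j+1} F_k G_l ([l ≤ i < k] - [k ≤ i < l]).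
  Bez : ℕ → Poly → Poly → Mat
  Bez m F G i j =
    ∑ 0 (suc m) (λ k → ∑ 0 (suc m) (λ l → term k l))
    where
    term : ℕ → ℕ → Carrier
    term k l with i +ℕ j +ℕ 1 ≟ k +ℕ l
    ... | yes _ = F k * G l * ([ l ≤ i < k ] - [ k ≤ i < l ])
    ... | no  _ = 0#

  Bez₁ : ℕ → Poly → Poly → Mat
  Bez₁ m F G i j = Bez m F G (i ∸ 1) (j ∸ 1)

  module Setup (r : ℕ) (s : Fin r → Carrier) where

    S : ℕ → Carrier
    S zero    = 1#
    S (suc k) with k <? r
    ... | yes p = s (fromℕ< p)
    ... | no  _ = 0#

    Sd : ℕ → ℕ → Carrier
    Sd i j with j ≤? i
    ... | yes _ = S (i ∸ j)
    ... | no  _ = 0#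

    f : Poly
    f k with k ≤? r
    ... | yes _ = S (r ∸ k)
    ... | no  _ = 0#

    T₁ : Mat
    T₁ i j with i ≤? j
    ... | yes _ = ι (j ∸ i) * S (r ∸ (j ∸ i))
    ... | no  _ = 0#

    T₂ : Mat
    T₂ i j = Sd i j

    T₃ : Mat
    T₃ i j with i ≤? j
    ... | yes _ = S (r ∸ (j ∸ i))
    ... | no  _ = 0#

    T₄ : Mat
    T₄ i j with j ≤? i
    ... | yes _ = ι (r ∸ (i ∸ j)) * S (i ∸ j)
    ... | no  _ = 0#

    u : ℕ → Carrier
    u i = ι (r ∸ i) * S i

    v : ℕ → Carrier
    v j = ι (r ∸ j) * S (r ∸ j)

    -- rinv plays the role of 1/r
    module WithInv (rinv : Carrier) where

      LHS : Mat
      LHS i j = (- (T₁ ⊗[ r ∸ 1 ] T₂) i j + (T₃ ⊗[ r ∸ 1 ] T₄) i j)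
                - rinv * (u i * v j)

      G : Poly
      G = f -ₚ (rinv ·ₚ mulX (deriv f))

      Bᵣ : Mat
      Bᵣ = J (r ∸ 1) ⊗[ r ∸ 1 ] Bez₁ (r ∸ 1) (deriv f) G

{-# OPTIONS --safe #-}
-- Fix the entry (i, j), put d = r - j + i and g(t) = (d - t)(r - t) s_t s_(d-t).  Both sides are
-- 1/r times signed sums of g over intervals.  On the left only k >= max(i, j) contributes, and with
-- t = k - j the k-th term of T₃T₄ - T₁T₂ is (d - 2t) s_t s_(d-t) = (g(t) - g(d - t))/r; the
-- reflection t ↦ d - t, which fixes s_t s_(d-t), turns the second half into a sum of g starting at
-- i + 1, while the rank-one correction is g(i)/r.  On the right, J picks row r - 1 - i of the Bézout
-- matrix, and only its antidiagonal k + l = r - 1 - i + j contributes; with t = r - 1 - k the term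
-- f'_k G_l is g(t)/r, counted with sign + for t in [i ∸ j, i) and - for t in [r - j, r).  Since g
-- vanishes from min(r, d) on, comparing prefix sums of g shows that the two sides coincide.
module Submission where

open import Defs
open import Level using (Level)
open import Data.Nat using (ℕ; zero; suc; _≤_; _<_; _∸_; _≤?_; _<?_; _≟_; _⊓_; z≤n; s≤s)
import Data.Nat as ℕ
import Data.Nat.Properties as ℕ
open import Data.Integer as ℤ using (ℤ; +_; -[1+_])
import Data.Integer.Properties as ℤ
open import Data.Sign as Sign using (Sign)
open import Data.Fin using (Fin)
open import Data.Maybe using (Maybe; map)
open import Data.Product using (Σ; _×_; _,_; proj₁; proj₂)
open import Data.Sum using (inj₁; inj₂)
open import Function using (_⇔_; mk⇔; Equivalence)
open import Relation.Nullary using (¬_; Dec; yes; no)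
open import Relation.Nullary.Decidable using (_×-dec_)
open import Relation.Nullary.Negation using (contradiction)
open import Relation.Binary.PropositionalEquality as ≡ using (_≡_; _≢_)
open import Relation.Binary.Consequences using (dec⇒weaklyDec)
open import Algebra.Bundles using (CommutativeRing)
open import Algebra.Solver.Ring.AlmostCommutativeRing
  using (_-Raw-AlmostCommutative⟶_; fromCommutativeRing)
import Algebra.Solver.Ring

+-cross-< : ∀ {m n o p} → m ℕ.+ n ≡ o ℕ.+ p → m < o → p < n
+-cross-< {m} {n} {o} {p} eq m<o with p <? n
... | yes p<n = p<n
... | no p≮n = contradiction (begin-strict
  m ℕ.+ n  <⟨ ℕ.+-monoˡ-< n m<o ⟩
  o ℕ.+ n  ≤⟨ ℕ.+-monoʳ-≤ o (ℕ.≮⇒≥ p≮n) ⟩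
  o ℕ.+ p  ≡⟨ eq ⟨
  m ℕ.+ n  ∎) (ℕ.<-irrefl ≡.refl)
  where open ℕ.≤-Reasoning

+-cross-<-⇔ : ∀ {m n o p} → m ℕ.+ n ≡ o ℕ.+ p → (m < o ⇔ p < n)
+-cross-<-⇔ {m} {n} {o} {p} eq = mk⇔ (+-cross-< eq) (+-cross-< flipped)
  where
  flipped : p ℕ.+ o ≡ n ℕ.+ m
  flipped = ≡.trans (ℕ.+-comm p o) (≡.trans (≡.sym eq) (ℕ.+-comm m n))

+-cross-≤-⇔ : ∀ {m n o p} → m ℕ.+ n ≡ o ℕ.+ p → (m ≤ o ⇔ p ≤ n)
+-cross-≤-⇔ {m} {n} {o} {p} eq = mk⇔
  (λ m≤o → ℕ.≮⇒≥ (λ n<p → ℕ.<⇒≱ (Equivalence.from (+-cross-<-⇔ (≡.sym eq)) n<p) m≤o))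
  (λ p≤n → ℕ.≮⇒≥ (λ o<m → ℕ.<⇒≱ (Equivalence.to (+-cross-<-⇔ (≡.sym eq)) o<m) p≤n))

m∸n≤o⇒m≤n+o : ∀ {m n o} → m ∸ n ≤ o → m ≤ n ℕ.+ o
m∸n≤o⇒m≤n+o {m} {n} m∸n≤o = ℕ.≤-trans (ℕ.m≤n+m∸n m n) (ℕ.+-monoʳ-≤ n m∸n≤o)

r∸x≡[r∸j+i]∸y : ∀ {r i j x y} → j ≤ r → x ℕ.+ i ≡ y ℕ.+ j → x ≤ r → r ∸ x ≡ (r ∸ j ℕ.+ i) ∸ y
r∸x≡[r∸j+i]∸y {r} {i} {j} {x} {y} j≤r x+i≡y+j x≤r =
  ≡.trans (≡.sym (ℕ.m+n∸n≡m (r ∸ x) y)) (≡.cong (_∸ y) (ℕ.+-cancelʳ-≡ j _ _ (begin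
    r ∸ x ℕ.+ y ℕ.+ j        ≡⟨ ℕ.+-assoc (r ∸ x) y j ⟩
    r ∸ x ℕ.+ (y ℕ.+ j)      ≡⟨ ≡.cong (r ∸ x ℕ.+_) x+i≡y+j ⟨
    r ∸ x ℕ.+ (x ℕ.+ i)      ≡⟨ ℕ.+-assoc (r ∸ x) x i ⟨
    r ∸ x ℕ.+ x ℕ.+ i        ≡⟨ ≡.cong (ℕ._+ i) (ℕ.m∸n+n≡m x≤r) ⟩
    r ℕ.+ i                  ≡⟨ ≡.cong (ℕ._+ i) (ℕ.m∸n+n≡m j≤r) ⟨
    r ∸ j ℕ.+ j ℕ.+ i        ≡⟨ ℕ.+-assoc (r ∸ j) j i ⟩
    r ∸ j ℕ.+ (j ℕ.+ i)      ≡⟨ ≡.cong (r ∸ j ℕ.+_) (ℕ.+-comm j i) ⟩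
    r ∸ j ℕ.+ (i ℕ.+ j)      ≡⟨ ℕ.+-assoc (r ∸ j) i j ⟨
    r ∸ j ℕ.+ i ℕ.+ j        ∎)))
  where open ≡.≡-Reasoning

i+[[r∸j]∸[i∸j]]≡r⊓[r∸j+i] : ∀ {r i j} → j ≤ r → i ≤ r → i ℕ.+ ((r ∸ j) ∸ (i ∸ j)) ≡ r ⊓ (r ∸ j ℕ.+ i)
i+[[r∸j]∸[i∸j]]≡r⊓[r∸j+i] {r} {i} {j} j≤r i≤r = begin
  i ℕ.+ (rj ∸ x₀)        ≡⟨ ℕ.+-∸-assoc i (ℕ.∸-monoˡ-≤ j i≤r) ⟨
  i ℕ.+ rj ∸ x₀          ≡⟨ ≡.cong (_∸ x₀) (ℕ.+-comm i rj) ⟩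
  rj ℕ.+ i ∸ x₀          ≡⟨ ℕ.+-∸-assoc rj (ℕ.m∸n≤m i j) ⟩
  rj ℕ.+ (i ∸ x₀)        ≡⟨ ≡.cong (rj ℕ.+_) i∸x₀≡j⊓i ⟩
  rj ℕ.+ (j ⊓ i)         ≡⟨ ℕ.+-distribˡ-⊓ rj j i ⟩
  (rj ℕ.+ j) ⊓ (rj ℕ.+ i) ≡⟨ ≡.cong (_⊓ (rj ℕ.+ i)) (ℕ.m∸n+n≡m j≤r) ⟩
  r ⊓ (rj ℕ.+ i)         ∎
  where
  open ≡.≡-Reasoning
  rj = r ∸ j
  x₀ = i ∸ j
  i∸x₀≡j⊓i : i ∸ x₀ ≡ j ⊓ i
  i∸x₀≡j⊓i = ≡.trans (≡.cong (_∸ x₀) (≡.sym (ℕ.m⊓n+n∸m≡n j i))) (ℕ.m+n∸n≡m (j ⊓ i) x₀)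

m∸n≤o⇒m∸o≤n : ∀ {n m k} → n ∸ m ≤ k → n ∸ k ≤ m
m∸n≤o⇒m∸o≤n {n} {m} {k} n∸m≤k = ℕ.m≤n+o⇒m∸n≤o n k (begin
  n               ≤⟨ ℕ.m≤n+m∸n n m ⟩
  m ℕ.+ (n ∸ m)   ≤⟨ ℕ.+-monoʳ-≤ m n∸m≤k ⟩
  m ℕ.+ k         ≡⟨ ℕ.+-comm m k ⟩
  k ℕ.+ m         ∎)
  where open ℕ.≤-Reasoning

module NatEmbedding {c ℓ : Level} (R : CommutativeRing c ℓ) where
  open CommutativeRing R
  open import Algebra.Properties.Semiring.Mult semiring using (×-homo-+; ×1-homo-*) renaming (_×_ to _×ᵤ_)
  open import Relation.Binary.Reasoning.Setoid setoid

  ι≡×1# : ∀ n → ι R n ≡ n ×ᵤ 1#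
  ι≡×1# zero    = ≡.refl
  ι≡×1# (suc n) = ≡.cong (λ x → 1# + x) (ι≡×1# n)

  ι-+ : ∀ m n → ι R (m ℕ.+ n) ≈ ι R m + ι R n
  ι-+ m n rewrite ι≡×1# (m ℕ.+ n) | ι≡×1# m | ι≡×1# n = ×-homo-+ 1# m n

  ι-* : ∀ m n → ι R (m ℕ.* n) ≈ ι R m * ι R n
  ι-* m n rewrite ι≡×1# (m ℕ.* n) | ι≡×1# m | ι≡×1# n = ×1-homo-* m n

  ι-∸ : ∀ {m n} → n ≤ m → ι R (m ∸ n) ≈ ι R m - ι R n
  ι-∸ {m} {n} n≤m = begin
    ι R (m ∸ n)                    ≈⟨ +-identityʳ _ ⟨
    ι R (m ∸ n) + 0#               ≈⟨ +-congˡ (-‿inverseʳ _) ⟨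
    ι R (m ∸ n) + (ι R n - ι R n)  ≈⟨ +-assoc _ _ _ ⟨
    ι R (m ∸ n) + ι R n - ι R n    ≈⟨ +-congʳ (ι-+ (m ∸ n) n) ⟨
    ι R (m ∸ n ℕ.+ n) - ι R n      ≡⟨ ≡.cong (λ k → ι R k - ι R n) (ℕ.m∸n+n≡m n≤m) ⟩
    ι R m - ι R n                  ∎

-- The ring solver normalises over a coefficient ring with decidable equality; ℤ maps into every
-- commutative ring.
module IntegerCoefficients {c ℓ : Level} (R : CommutativeRing c ℓ) where
  open CommutativeRing R
  open NatEmbedding R
  open import Algebra.Properties.Ring ring using (-0#≈0#; -‿involutive; -1*x≈-x; -‿anti-homo-+; ⁻¹-anti-homo‿-)
  open import Algebra.Properties.CommutativeSemigroup *-commutativeSemigroup using (interchange)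
  open import Relation.Binary.Reasoning.Setoid setoid

  ⟦_⟧ : ℤ → Carrier
  ⟦ + n ⟧      = ι R n
  ⟦ -[1+ n ] ⟧ = - ι R (suc n)

  ⟦-⟧ : ∀ z → ⟦ ℤ.- z ⟧ ≈ - ⟦ z ⟧
  ⟦-⟧ (+ zero)   = sym -0#≈0#
  ⟦-⟧ (+ suc n)  = refl
  ⟦-⟧ -[1+ n ]   = sym (-‿involutive _)

  ⟦⊖⟧ : ∀ m n → ⟦ m ℤ.⊖ n ⟧ ≈ ι R m - ι R n
  ⟦⊖⟧ m n with ℕ.≤-total n m
  ... | inj₁ n≤m = begin
    ⟦ m ℤ.⊖ n ⟧     ≡⟨ ≡.cong ⟦_⟧ (ℤ.⊖-≥ n≤m) ⟩
    ι R (m ∸ n)     ≈⟨ ι-∸ n≤m ⟩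
    ι R m - ι R n   ∎
  ... | inj₂ m≤n = begin
    ⟦ m ℤ.⊖ n ⟧             ≡⟨ ≡.cong ⟦_⟧ (ℤ.⊖-≤ m≤n) ⟩
    ⟦ ℤ.- (+ (n ∸ m)) ⟧     ≈⟨ ⟦-⟧ (+ (n ∸ m)) ⟩
    - ι R (n ∸ m)           ≈⟨ -‿cong (ι-∸ m≤n) ⟩
    - (ι R n - ι R m)       ≈⟨ ⁻¹-anti-homo‿- _ _ ⟩
    ι R m - ι R n           ∎

  ⟦+⟧ : ∀ x y → ⟦ x ℤ.+ y ⟧ ≈ ⟦ x ⟧ + ⟦ y ⟧
  ⟦+⟧ (+ m)    (+ n)    = ι-+ m n
  ⟦+⟧ (+ m)    -[1+ n ] = ⟦⊖⟧ m (suc n)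
  ⟦+⟧ -[1+ m ] (+ n)    = trans (⟦⊖⟧ n (suc m)) (+-comm _ _)
  ⟦+⟧ -[1+ m ] -[1+ n ] = begin
    - ι R (suc (suc (m ℕ.+ n)))       ≡⟨ ≡.cong (λ k → - ι R k) (ℕ.+-suc (suc m) n) ⟨
    - ι R (suc m ℕ.+ suc n)           ≈⟨ -‿cong (ι-+ (suc m) (suc n)) ⟩
    - (ι R (suc m) + ι R (suc n))     ≈⟨ -‿anti-homo-+ _ _ ⟩
    - ι R (suc n) + - ι R (suc m)     ≈⟨ +-comm _ _ ⟩
    - ι R (suc m) + - ι R (suc n)     ∎

  ⟦_⟧ₛ : Sign → Carrier
  ⟦ Sign.+ ⟧ₛ = 1#
  ⟦ Sign.- ⟧ₛ = - 1#

  ⟦◃⟧ : ∀ s n → ⟦ s ℤ.◃ n ⟧ ≈ ⟦ s ⟧ₛ * ι R n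
  ⟦◃⟧ _      zero    = sym (zeroʳ _)
  ⟦◃⟧ Sign.+ (suc n) = sym (*-identityˡ _)
  ⟦◃⟧ Sign.- (suc n) = sym (-1*x≈-x _)

  ⟦⟧-sign-abs : ∀ z → ⟦ z ⟧ ≈ ⟦ ℤ.sign z ⟧ₛ * ι R ℤ.∣ z ∣
  ⟦⟧-sign-abs z = trans (reflexive (≡.cong ⟦_⟧ (≡.sym (ℤ.◃-inverse z)))) (⟦◃⟧ (ℤ.sign z) ℤ.∣ z ∣)

  ⟦*⟧ₛ : ∀ s t → ⟦ s Sign.* t ⟧ₛ ≈ ⟦ s ⟧ₛ * ⟦ t ⟧ₛ
  ⟦*⟧ₛ Sign.+ t      = sym (*-identityˡ _)
  ⟦*⟧ₛ Sign.- Sign.+ = sym (*-identityʳ _)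
  ⟦*⟧ₛ Sign.- Sign.- = sym (trans (-1*x≈-x _) (-‿involutive _))

  ⟦*⟧ : ∀ x y → ⟦ x ℤ.* y ⟧ ≈ ⟦ x ⟧ * ⟦ y ⟧
  ⟦*⟧ x y = begin
    ⟦ sx Sign.* sy ℤ.◃ ∣x∣ ℕ.* ∣y∣ ⟧                ≈⟨ ⟦◃⟧ (sx Sign.* sy) (∣x∣ ℕ.* ∣y∣) ⟩
    ⟦ sx Sign.* sy ⟧ₛ * ι R (∣x∣ ℕ.* ∣y∣)             ≈⟨ *-cong (⟦*⟧ₛ sx sy) (ι-* ∣x∣ ∣y∣) ⟩
    (⟦ sx ⟧ₛ * ⟦ sy ⟧ₛ) * (ι R ∣x∣ * ι R ∣y∣)         ≈⟨ interchange _ _ _ _ ⟩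
    (⟦ sx ⟧ₛ * ι R ∣x∣) * (⟦ sy ⟧ₛ * ι R ∣y∣)         ≈⟨ *-cong (⟦⟧-sign-abs x) (⟦⟧-sign-abs y) ⟨
    ⟦ x ⟧ * ⟦ y ⟧                                     ∎
    where
    sx = ℤ.sign x
    sy = ℤ.sign y
    ∣x∣ = ℤ.∣ x ∣
    ∣y∣ = ℤ.∣ y ∣

  homomorphism : ℤ.+-*-rawRing -Raw-AlmostCommutative⟶ fromCommutativeRing R
  homomorphism = record
    { ⟦_⟧ = ⟦_⟧ ; +-homo = ⟦+⟧ ; *-homo = ⟦*⟧ ; -‿homo = ⟦-⟧
    ; 0-homo = refl ; 1-homo = +-identityʳ 1# }

  coefficient-equality : ∀ x y → Maybe (⟦ x ⟧ ≈ ⟦ y ⟧)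
  coefficient-equality x y = map (λ x≡y → reflexive (≡.cong ⟦_⟧ x≡y)) (dec⇒weaklyDec ℤ._≟_ x y)

  open Algebra.Solver.Ring ℤ.+-*-rawRing (fromCommutativeRing R) homomorphism coefficient-equality
    public using (solve; _:=_; _:*_; _:-_)

module Sums {c ℓ : Level} (R : CommutativeRing c ℓ) where
  open CommutativeRing R
  open import Algebra.Properties.Ring ring using (-0#≈0#; -‿anti-homo-+)
  open import Algebra.Properties.CommutativeSemigroup +-commutativeSemigroup using (interchange)
  open import Relation.Binary.Reasoning.Setoid setoid

  InRange : ℕ → ℕ → ℕ → Set
  InRange a n t = a ≤ t × t < a ℕ.+ n

  private
    inRange-suc : ∀ {a n t} → InRange (suc a) n t → InRange a (suc n) t
    inRange-suc {a} {n} {t} (a<t , t<) = ℕ.<⇒≤ a<t , ≡.subst (t <_) (≡.sym (ℕ.+-suc a n)) t<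

    first : ∀ a n → InRange a (suc n) a
    first a n = ℕ.≤-refl , ℕ.m<m+n a (s≤s z≤n)

  ∑-cong : ∀ a n {f g : ℕ → Carrier} → (∀ t → InRange a n t → f t ≈ g t) → ∑ R a n f ≈ ∑ R a n g
  ∑-cong a zero    f≈g = refl
  ∑-cong a (suc n) f≈g = +-cong (f≈g a (first a n)) (∑-cong (suc a) n (λ t t∈ → f≈g t (inRange-suc t∈)))

  ∑-zero : ∀ a n {f : ℕ → Carrier} → (∀ t → InRange a n t → f t ≈ 0#) → ∑ R a n f ≈ 0#
  ∑-zero a zero    f≈0 = refl
  ∑-zero a (suc n) f≈0 =
    trans (+-cong (f≈0 a (first a n)) (∑-zero (suc a) n (λ t t∈ → f≈0 t (inRange-suc t∈)))) (+-identityʳ 0#)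

  ∑-+ : ∀ a n (f g : ℕ → Carrier) → ∑ R a n (λ t → f t + g t) ≈ ∑ R a n f + ∑ R a n g
  ∑-+ a zero    f g = sym (+-identityʳ 0#)
  ∑-+ a (suc n) f g = trans (+-congˡ (∑-+ (suc a) n f g)) (interchange _ _ _ _)

  ∑-neg : ∀ a n (f : ℕ → Carrier) → ∑ R a n (λ t → - f t) ≈ - ∑ R a n f
  ∑-neg a zero    f = sym -0#≈0#
  ∑-neg a (suc n) f = trans (+-congˡ (∑-neg (suc a) n f)) (trans (+-comm _ _) (sym (-‿anti-homo-+ _ _)))

  ∑-- : ∀ a n (f g : ℕ → Carrier) → ∑ R a n (λ t → f t - g t) ≈ ∑ R a n f - ∑ R a n g
  ∑-- a n f g = trans (∑-+ a n f (λ t → - g t)) (+-congˡ (∑-neg a n g))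

  ∑-*ˡ : ∀ a n x (f : ℕ → Carrier) → ∑ R a n (λ t → x * f t) ≈ x * ∑ R a n f
  ∑-*ˡ a zero    x f = sym (zeroʳ x)
  ∑-*ˡ a (suc n) x f = trans (+-congˡ (∑-*ˡ (suc a) n x f)) (sym (distribˡ x _ _))

  ∑-++ : ∀ a m n (f : ℕ → Carrier) → ∑ R a (m ℕ.+ n) f ≈ ∑ R a m f + ∑ R (a ℕ.+ m) n f
  ∑-++ a zero    n f rewrite ℕ.+-identityʳ a = sym (+-identityˡ _)
  ∑-++ a (suc m) n f rewrite ℕ.+-suc a m = trans (+-congˡ (∑-++ (suc a) m n f)) (sym (+-assoc _ _ _))

  ∑-shift : ∀ b a n (f : ℕ → Carrier) → ∑ R (b ℕ.+ a) n f ≈ ∑ R a n (λ t → f (b ℕ.+ t))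
  ∑-shift b a zero    f = refl
  ∑-shift b a (suc n) f rewrite ≡.sym (ℕ.+-suc b a) = +-congˡ (∑-shift b (suc a) n f)

  ∑-snoc : ∀ a n (f : ℕ → Carrier) → ∑ R a (suc n) f ≈ ∑ R a n f + f (a ℕ.+ n)
  ∑-snoc a n f = begin
    ∑ R a (1 ℕ.+ n) f            ≡⟨ ≡.cong (λ m → ∑ R a m f) (ℕ.+-comm 1 n) ⟩
    ∑ R a (n ℕ.+ 1) f            ≈⟨ ∑-++ a n 1 f ⟩
    ∑ R a n f + (f (a ℕ.+ n) + 0#) ≈⟨ +-congˡ (+-identityʳ _) ⟩
    ∑ R a n f + f (a ℕ.+ n)      ∎

  ∑-reverse : ∀ b a n (f : ℕ → Carrier) → a ℕ.+ n ≤ suc b →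
              ∑ R a n (λ t → f (b ∸ t)) ≈ ∑ R (suc b ∸ (a ℕ.+ n)) n f
  ∑-reverse b a zero    f _ = refl
  ∑-reverse b a (suc n) f a+n<b rewrite ℕ.+-suc a n = begin
    f (b ∸ a) + ∑ R (suc a) n (λ t → f (b ∸ t))   ≈⟨ +-congˡ (∑-reverse b (suc a) n f a+n<b) ⟩
    f (b ∸ a) + ∑ R (b ∸ (a ℕ.+ n)) n f          ≈⟨ +-comm _ _ ⟩
    ∑ R (b ∸ (a ℕ.+ n)) n f + f (b ∸ a)          ≡⟨ ≡.cong (λ x → ∑ R (b ∸ (a ℕ.+ n)) n f + f x) last ⟨
    ∑ R (b ∸ (a ℕ.+ n)) n f + f (b ∸ (a ℕ.+ n) ℕ.+ n)  ≈⟨ ∑-snoc _ n f ⟨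
    ∑ R (b ∸ (a ℕ.+ n)) (suc n) f                ∎
    where
    last : b ∸ (a ℕ.+ n) ℕ.+ n ≡ b ∸ a
    last = ≡.trans (≡.cong (ℕ._+ n) (≡.sym (ℕ.∸-+-assoc b a n)))
                   (ℕ.m∸n+n≡m (ℕ.m+n≤o⇒m≤o∸n n (≡.subst (_≤ b) (ℕ.+-comm a n) (ℕ.≤-pred a+n<b))))

  ∑-single : ∀ a n k {f : ℕ → Carrier} → InRange a n k → (∀ t → InRange a n t → t ≢ k → f t ≈ 0#) →
             ∑ R a n f ≈ f k
  ∑-single a zero k (a≤k , k<a+0) _ = contradiction k<a+0 (ℕ.≤⇒≯ (≡.subst (_≤ k) (≡.sym (ℕ.+-identityʳ a)) a≤k))
  ∑-single a (suc n) k {f} k∈ others with a ℕ.≟ k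
  ... | yes ≡.refl = begin
    f a + ∑ R (suc a) n f ≈⟨ +-congˡ (∑-zero (suc a) n λ t t∈@(a<t , _) → others t (inRange-suc t∈) (ℕ.>⇒≢ a<t)) ⟩
    f a + 0#             ≈⟨ +-identityʳ _ ⟩
    f a                  ∎
  ... | no a≢k = begin
    f a + ∑ R (suc a) n f ≈⟨ +-cong (others a (first a n) a≢k) (∑-single (suc a) n k k∈′ (λ t t∈ → others t (inRange-suc t∈))) ⟩
    0# + f k             ≈⟨ +-identityˡ _ ⟩
    f k                  ∎
    where
    k∈′ : InRange (suc a) n k
    k∈′ = let (a≤k , k<) = k∈ in ℕ.≤∧≢⇒< a≤k a≢k , ≡.subst (k <_) (ℕ.+-suc a n) k<

  ∑-prefixes : ∀ a n (f : ℕ → Carrier) → ∑ R a n f ≈ ∑ R 0 (a ℕ.+ n) f - ∑ R 0 a f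
  ∑-prefixes a n f = begin
    ∑ R a n f                          ≈⟨ +-identityˡ _ ⟨
    0# + ∑ R a n f                     ≈⟨ +-congʳ (-‿inverseˡ _) ⟨
    (- ∑ R 0 a f + ∑ R 0 a f) + ∑ R a n f ≈⟨ +-assoc _ _ _ ⟩
    - ∑ R 0 a f + (∑ R 0 a f + ∑ R a n f) ≈⟨ +-comm _ _ ⟩
    (∑ R 0 a f + ∑ R a n f) - ∑ R 0 a f  ≈⟨ +-congʳ (∑-++ 0 a n f) ⟨
    ∑ R 0 (a ℕ.+ n) f - ∑ R 0 a f        ∎

  ∑-prefix-stable : ∀ z m (f : ℕ → Carrier) → (∀ t → z ≤ t → f t ≈ 0#) → z ≤ m → ∑ R 0 m f ≈ ∑ R 0 z f
  ∑-prefix-stable z m f vanish z≤m = begin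
    ∑ R 0 m f                      ≡⟨ ≡.cong (λ n → ∑ R 0 n f) (ℕ.m+[n∸m]≡n z≤m) ⟨
    ∑ R 0 (z ℕ.+ (m ∸ z)) f        ≈⟨ ∑-++ 0 z (m ∸ z) f ⟩
    ∑ R 0 z f + ∑ R z (m ∸ z) f     ≈⟨ +-congˡ (∑-zero z (m ∸ z) (λ t (z≤t , _) → vanish t z≤t)) ⟩
    ∑ R 0 z f + 0#                 ≈⟨ +-identityʳ _ ⟩
    ∑ R 0 z f                      ∎

  ∑-from : ∀ {a b} n {f : ℕ → Carrier} → a ≤ b → b ≤ a ℕ.+ n → (∀ t → a ≤ t → t < b → f t ≈ 0#) →
           ∑ R a n f ≈ ∑ R b (a ℕ.+ n ∸ b) f
  ∑-from {a} {b} n {f} a≤b b≤a+n f≈0 = begin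
    ∑ R a n f                                     ≡⟨ ≡.cong (λ m → ∑ R a m f) n≡ ⟩
    ∑ R a ((b ∸ a) ℕ.+ (a ℕ.+ n ∸ b)) f            ≈⟨ ∑-++ a (b ∸ a) _ f ⟩
    ∑ R a (b ∸ a) f + ∑ R (a ℕ.+ (b ∸ a)) (a ℕ.+ n ∸ b) f
      ≈⟨ +-cong (∑-zero a (b ∸ a) (λ t (a≤t , t<) → f≈0 t a≤t (≡.subst (t <_) a+[b∸a] t<)))
                (reflexive (≡.cong (λ c → ∑ R c (a ℕ.+ n ∸ b) f) a+[b∸a])) ⟩
    0# + ∑ R b (a ℕ.+ n ∸ b) f                     ≈⟨ +-identityˡ _ ⟩
    ∑ R b (a ℕ.+ n ∸ b) f                          ∎
    where
    a+[b∸a] : a ℕ.+ (b ∸ a) ≡ b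
    a+[b∸a] = ℕ.m+[n∸m]≡n a≤b
    n≡ : n ≡ (b ∸ a) ℕ.+ (a ℕ.+ n ∸ b)
    n≡ = ℕ.+-cancelˡ-≡ a _ _ (≡.sym (≡.trans (≡.sym (ℕ.+-assoc a (b ∸ a) _))
           (≡.trans (≡.cong (ℕ._+ (a ℕ.+ n ∸ b)) a+[b∸a]) (ℕ.m+[n∸m]≡n b≤a+n))))

module Indicators {c ℓ : Level} (R : CommutativeRing c ℓ) where
  open CommutativeRing R
  open Sums R
  open import Relation.Binary.Reasoning.Setoid setoid

  private
    [_≤_<_]′ = [_≤_<_] R

  indicator-in : ∀ {a x b} → a ≤ x → x < b → [ a ≤ x < b ]′ ≈ 1#
  indicator-in {a} {x} {b} a≤x x<b with a ≤? x | x <? b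
  ... | yes _ | yes _   = refl
  ... | no a≰x | _      = contradiction a≤x a≰x
  ... | yes _ | no x≮b  = contradiction x<b x≮b

  indicator-out : ∀ {a x b} → ¬ (a ≤ x × x < b) → [ a ≤ x < b ]′ ≈ 0#
  indicator-out {a} {x} {b} ∉ with a ≤? x | x <? b
  ... | yes a≤x | yes x<b = contradiction (a≤x , x<b) ∉
  ... | no _    | _       = refl
  ... | yes _   | no _    = refl

  indicator-below : ∀ {a x} b → x < a → [ a ≤ x < b ]′ ≈ 0#
  indicator-below b x<a = indicator-out {b = b} λ (a≤x , _) → ℕ.<⇒≱ x<a a≤x

  indicator-above : ∀ a {x b} → b ≤ x → [ a ≤ x < b ]′ ≈ 0#
  indicator-above a b≤x = indicator-out {a} λ (_ , x<b) → ℕ.≤⇒≯ b≤x x<b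

  indicator-cong : ∀ {a x b a′ x′ b′} → (a ≤ x × x < b) ⇔ (a′ ≤ x′ × x′ < b′) →
                   [ a ≤ x < b ]′ ≈ [ a′ ≤ x′ < b′ ]′
  indicator-cong {a} {x} {b} P⇔Q with a ≤? x ×-dec x <? b
  ... | yes (a≤x , x<b) = let (a′≤x′ , x′<b′) = Equivalence.to P⇔Q (a≤x , x<b)
                          in trans (indicator-in a≤x x<b) (sym (indicator-in a′≤x′ x′<b′))
  ... | no ∉            = trans (indicator-out ∉) (sym (indicator-out (λ ∈′ → ∉ (Equivalence.from P⇔Q ∈′))))

  indicator-difference : ∀ l a k → [ l ≤ a < k ]′ - [ k ≤ a < l ]′ ≈ [ 0 ≤ a < k ]′ - [ 0 ≤ a < l ]′
  indicator-difference l a k = by-cases (a <? k) (a <? l)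
    where
    by-cases : Dec (a < k) → Dec (a < l) → [ l ≤ a < k ]′ - [ k ≤ a < l ]′ ≈ [ 0 ≤ a < k ]′ - [ 0 ≤ a < l ]′
    by-cases (yes a<k) (yes a<l) = begin
      [ l ≤ a < k ]′ - [ k ≤ a < l ]′ ≈⟨ +-cong (indicator-below k a<l) (-‿cong (indicator-below l a<k)) ⟩
      0# - 0#                         ≈⟨ -‿inverseʳ 0# ⟩
      0#                              ≈⟨ -‿inverseʳ 1# ⟨
      1# - 1#                         ≈⟨ +-cong (indicator-in z≤n a<k) (-‿cong (indicator-in z≤n a<l)) ⟨
      [ 0 ≤ a < k ]′ - [ 0 ≤ a < l ]′ ∎
    by-cases (yes a<k) (no a≮l) = begin
      [ l ≤ a < k ]′ - [ k ≤ a < l ]′ ≈⟨ +-cong (indicator-in (ℕ.≮⇒≥ a≮l) a<k) (-‿cong (indicator-above k (ℕ.≮⇒≥ a≮l))) ⟩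
      1# - 0#                         ≈⟨ +-cong (indicator-in z≤n a<k) (-‿cong (indicator-above 0 (ℕ.≮⇒≥ a≮l))) ⟨
      [ 0 ≤ a < k ]′ - [ 0 ≤ a < l ]′ ∎
    by-cases (no a≮k) (yes a<l) = begin
      [ l ≤ a < k ]′ - [ k ≤ a < l ]′ ≈⟨ +-cong (indicator-above l (ℕ.≮⇒≥ a≮k)) (-‿cong (indicator-in (ℕ.≮⇒≥ a≮k) a<l)) ⟩
      0# - 1#                         ≈⟨ +-cong (indicator-above 0 (ℕ.≮⇒≥ a≮k)) (-‿cong (indicator-in z≤n a<l)) ⟨
      [ 0 ≤ a < k ]′ - [ 0 ≤ a < l ]′ ∎
    by-cases (no a≮k) (no a≮l) = begin
      [ l ≤ a < k ]′ - [ k ≤ a < l ]′ ≈⟨ +-cong (indicator-above l (ℕ.≮⇒≥ a≮k)) (-‿cong (indicator-above k (ℕ.≮⇒≥ a≮l))) ⟩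
      0# - 0#                         ≈⟨ +-cong (indicator-above 0 (ℕ.≮⇒≥ a≮k)) (-‿cong (indicator-above 0 (ℕ.≮⇒≥ a≮l))) ⟨
      [ 0 ≤ a < k ]′ - [ 0 ≤ a < l ]′ ∎

  ∑-indicator : ∀ {a b} n (f : ℕ → Carrier) → a ≤ b → b ≤ n →
                ∑ R 0 n (λ t → [ a ≤ t < b ]′ * f t) ≈ ∑ R a (b ∸ a) f
  ∑-indicator {a} {b} n f a≤b b≤n = begin
    ∑ R 0 n χf                                           ≡⟨ ≡.cong (λ m → ∑ R 0 m χf) n≡ ⟩
    ∑ R 0 (a ℕ.+ ((b ∸ a) ℕ.+ (n ∸ b))) χf               ≈⟨ ∑-++ 0 a _ χf ⟩
    ∑ R 0 a χf + ∑ R a ((b ∸ a) ℕ.+ (n ∸ b)) χf          ≈⟨ +-congˡ (∑-++ a (b ∸ a) (n ∸ b) χf) ⟩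
    ∑ R 0 a χf + (∑ R a (b ∸ a) χf + ∑ R (a ℕ.+ (b ∸ a)) (n ∸ b) χf)
      ≈⟨ +-cong (∑-zero 0 a (λ t (_ , t<a) → vanish (indicator-below b t<a)))
                (+-cong (∑-cong a (b ∸ a) (λ t (a≤t , t<) → unit (indicator-in a≤t (≡.subst (t <_) a+[b∸a] t<))))
                        (∑-zero _ (n ∸ b) (λ t (b≤t , _) → vanish (indicator-above a (≡.subst (_≤ t) a+[b∸a] b≤t))))) ⟩
    0# + (∑ R a (b ∸ a) f + 0#)                          ≈⟨ trans (+-identityˡ _) (+-identityʳ _) ⟩
    ∑ R a (b ∸ a) f                                      ∎
    where
    χf = λ t → [ a ≤ t < b ]′ * f t
    a+[b∸a] : a ℕ.+ (b ∸ a) ≡ b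
    a+[b∸a] = ℕ.m+[n∸m]≡n a≤b
    n≡ : n ≡ a ℕ.+ ((b ∸ a) ℕ.+ (n ∸ b))
    n≡ = ≡.sym (≡.trans (≡.sym (ℕ.+-assoc a (b ∸ a) (n ∸ b)))
                        (≡.trans (≡.cong (ℕ._+ (n ∸ b)) a+[b∸a]) (ℕ.m+[n∸m]≡n b≤n)))
    vanish : ∀ {t} → [ a ≤ t < b ]′ ≈ 0# → χf t ≈ 0#
    vanish χ≈0 = trans (*-congʳ χ≈0) (zeroˡ _)
    unit : ∀ {t} → [ a ≤ t < b ]′ ≈ 1# → χf t ≈ f t
    unit χ≈1 = trans (*-congʳ χ≈1) (*-identityˡ _)

module BezoutEntries {c ℓ : Level} (R : CommutativeRing c ℓ) where
  open CommutativeRing R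
  open Sums R
  open Indicators R
  open import Relation.Binary.Reasoning.Setoid setoid

  private
    [_≤_<_]′ = [_≤_<_] R

  module _ (m : ℕ) (F G : Poly R) (a b : ℕ) where

    -- The summand of Bez is local to its where-block; unification recovers it.
    private
      unfold : Σ (ℕ → ℕ → Carrier) λ term → Bez R m F G a b ≡ ∑ R 0 (suc m) (λ k → ∑ R 0 (suc m) (term k))
      unfold = _ , ≡.refl

      term = proj₁ unfold

      term-diagonal : ∀ k l → a ℕ.+ b ℕ.+ 1 ≡ k ℕ.+ l → term k l ≈ F k * G l * ([ l ≤ a < k ]′ - [ k ≤ a < l ]′)
      term-diagonal k l on with a ℕ.+ b ℕ.+ 1 ≟ k ℕ.+ l
      ... | yes _  = refl
      ... | no off = contradiction on off

      term-off-diagonal : ∀ k l → a ℕ.+ b ℕ.+ 1 ≢ k ℕ.+ l → term k l ≈ 0#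
      term-off-diagonal k l off with a ℕ.+ b ℕ.+ 1 ≟ k ℕ.+ l
      ... | yes on = contradiction on off
      ... | no _   = refl

    -- The outer indicator says that k ≤ N and N ∸ k ≤ m, i.e. that row k meets the antidiagonal.
    Bez-antidiagonal :
      let N = a ℕ.+ b ℕ.+ 1 in
      Bez R m F G a b ≈
      ∑ R 0 (suc m) (λ k → [ N ∸ m ≤ k < suc N ]′ * (F k * G (N ∸ k) * ([ 0 ≤ a < k ]′ - [ 0 ≤ a < N ∸ k ]′)))
    Bez-antidiagonal = trans (reflexive (proj₂ unfold)) (∑-cong 0 (suc m) (λ k _ → row k))
      where
      N = a ℕ.+ b ℕ.+ 1

      contribution : ℕ → Carrier
      contribution k = F k * G (N ∸ k) * ([ 0 ≤ a < k ]′ - [ 0 ≤ a < N ∸ k ]′)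

      row : ∀ k → ∑ R 0 (suc m) (term k) ≈ [ N ∸ m ≤ k < suc N ]′ * contribution k
      row k with N ∸ m ≤? k ×-dec k <? suc N
      ... | yes (N∸m≤k , k<1+N) = begin
        ∑ R 0 (suc m) (term k)
          ≈⟨ ∑-single 0 (suc m) (N ∸ k) (z≤n , s≤s (m∸n≤o⇒m∸o≤n N∸m≤k)) others ⟩
        term k (N ∸ k)
          ≈⟨ term-diagonal k (N ∸ k) (≡.sym k+[N∸k]) ⟩
        F k * G (N ∸ k) * ([ N ∸ k ≤ a < k ]′ - [ k ≤ a < N ∸ k ]′)
          ≈⟨ *-congˡ (indicator-difference (N ∸ k) a k) ⟩
        contribution k
          ≈⟨ *-identityˡ _ ⟨
        1# * contribution k
          ≈⟨ *-congʳ (indicator-in N∸m≤k k<1+N) ⟨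
        [ N ∸ m ≤ k < suc N ]′ * contribution k
          ∎
        where
        k+[N∸k] : k ℕ.+ (N ∸ k) ≡ N
        k+[N∸k] = ℕ.m+[n∸m]≡n (ℕ.≤-pred k<1+N)
        others : ∀ l → _ → l ≢ N ∸ k → term k l ≈ 0#
        others l _ l≢N∸k = term-off-diagonal k l λ N≡k+l →
          l≢N∸k (ℕ.+-cancelˡ-≡ k l (N ∸ k) (≡.trans (≡.sym N≡k+l) (≡.sym k+[N∸k])))
      ... | no ∉ = begin
        ∑ R 0 (suc m) (term k) ≈⟨ ∑-zero 0 (suc m) (λ l (_ , l≤m) → term-off-diagonal k l (off l (ℕ.≤-pred l≤m))) ⟩
        0#                     ≈⟨ zeroˡ _ ⟨
        0# * contribution k    ≈⟨ *-congʳ (indicator-out ∉) ⟨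
        [ N ∸ m ≤ k < suc N ]′ * contribution k
          ∎
        where
        off : ∀ l → l ≤ m → N ≢ k ℕ.+ l
        off l l≤m N≡k+l =
          ∉ (m∸n≤o⇒m∸o≤n (≡.subst (_≤ m) N∸k≡l l≤m) , s≤s (≡.subst (k ≤_) (≡.sym N≡k+l) (ℕ.m≤m+n k l)))
          where
          N∸k≡l : l ≡ N ∸ k
          N∸k≡l = ≡.trans (≡.sym (ℕ.m+n∸m≡n k l)) (≡.cong (_∸ k) (≡.sym N≡k+l))

  J-antidiagonal : ∀ n {i k} → i ℕ.+ k ≡ suc n → J R n i k ≈ 1#
  J-antidiagonal n {i} {k} on with i ℕ.+ k ≟ suc n
  ... | yes _  = refl
  ... | no off = contradiction on off

  J-off-antidiagonal : ∀ n {i k} → i ℕ.+ k ≢ suc n → J R n i k ≈ 0#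
  J-off-antidiagonal n {i} {k} off with i ℕ.+ k ≟ suc n
  ... | yes on = contradiction on off
  ... | no _   = refl

  J-⊗ : ∀ n (M : Mat R) {i} j → 1 ≤ i → i ≤ n → _⊗[_]_ R (J R n) n M i j ≈ M (suc n ∸ i) j
  J-⊗ n M {i} j 1≤i i≤n = begin
    ∑ R 1 n (λ k → J R n i k * M k j)
      ≈⟨ ∑-single 1 n (suc n ∸ i) (ℕ.m<n⇒0<n∸m (s≤s i≤n) , ℕ.∸-monoʳ-< 1≤i i≤1+n) others ⟩
    J R n i (suc n ∸ i) * M (suc n ∸ i) j
      ≈⟨ *-congʳ (J-antidiagonal n {i} (ℕ.m+[n∸m]≡n i≤1+n)) ⟩
    1# * M (suc n ∸ i) j
      ≈⟨ *-identityˡ _ ⟩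
    M (suc n ∸ i) j
      ∎
    where
    i≤1+n : i ≤ suc n
    i≤1+n = ℕ.m≤n⇒m≤1+n i≤n
    others : ∀ k → _ → k ≢ suc n ∸ i → J R n i k * M k j ≈ 0#
    others k _ k≢ = trans (*-congʳ (J-off-antidiagonal n {i} {k} λ on → k≢ (k≡ on))) (zeroˡ _)
      where
      k≡ : i ℕ.+ k ≡ suc n → k ≡ suc n ∸ i
      k≡ on = ≡.trans (≡.sym (ℕ.m+n∸m≡n i k)) (≡.cong (_∸ i) on)

  mulX-deriv : ∀ (p : Poly R) l → mulX R (deriv R p) l ≈ ι R l * p l
  mulX-deriv p zero    = sym (zeroˡ _)
  mulX-deriv p (suc l) = refl

module Indices (D i j : ℕ) (i≤D : i ≤ D) (1≤j : 1 ≤ j) (j≤D : j ≤ D) where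

  open import Algebra.Properties.CommutativeSemigroup ℕ.+-commutativeSemigroup
    using (x∙yz≈xz∙y; xy∙z≈xz∙y; x∙yz≈zy∙x; xy∙z≈zy∙x; xy∙z≈x∙zy; x∙yz≈yx∙z)

  r rj x₀ d : ℕ
  r = suc D
  rj = r ∸ j
  x₀ = i ∸ j
  d = rj ℕ.+ i

  j≤r : j ≤ r
  j≤r = ℕ.m≤n⇒m≤1+n j≤D

  a b N : ℕ
  a = r ∸ i ∸ 1
  b = j ∸ 1
  N = a ℕ.+ b ℕ.+ 1

  a+i≡D : a ℕ.+ i ≡ D
  a+i≡D = ≡.trans (≡.cong (ℕ._+ i) a≡D∸i) (ℕ.m∸n+n≡m i≤D)
    where
    a≡D∸i : a ≡ D ∸ i
    a≡D∸i = ≡.trans (ℕ.∸-+-assoc r i 1) (≡.cong (r ∸_) (ℕ.+-comm i 1))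

  N≡a+j : N ≡ a ℕ.+ j
  N≡a+j = ≡.trans (ℕ.+-assoc a b 1) (≡.cong (a ℕ.+_) (ℕ.m∸n+n≡m 1≤j))

  module At (t : ℕ) (t≤D : t ≤ D) where

    k : ℕ
    k = D ∸ t

    k+t≡D : k ℕ.+ t ≡ D
    k+t≡D = ℕ.m∸n+n≡m t≤D

    r∸t≡1+k : r ∸ t ≡ suc k
    r∸t≡1+k = ≡.trans (≡.cong (_∸ t) (≡.cong suc (≡.sym k+t≡D))) (ℕ.m+n∸n≡m (suc k) t)

    r∸[1+k]≡t : r ∸ suc k ≡ t
    r∸[1+k]≡t = ≡.trans (≡.cong (_∸ suc k) (≡.cong suc (≡.sym k+t≡D))) (ℕ.m+n∸m≡n (suc k) t)

    a<k⇔t<i : a < k ⇔ t < i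
    a<k⇔t<i = +-cross-<-⇔ (≡.trans a+i≡D (≡.sym k+t≡D))

    k+[j+t]≡N+i : k ℕ.+ (j ℕ.+ t) ≡ N ℕ.+ i
    k+[j+t]≡N+i = begin
      k ℕ.+ (j ℕ.+ t)  ≡⟨ x∙yz≈xz∙y k j t ⟩
      k ℕ.+ t ℕ.+ j    ≡⟨ ≡.cong (ℕ._+ j) (≡.trans k+t≡D (≡.sym a+i≡D)) ⟩
      a ℕ.+ i ℕ.+ j    ≡⟨ xy∙z≈xz∙y a i j ⟩
      a ℕ.+ j ℕ.+ i    ≡⟨ ≡.cong (ℕ._+ i) N≡a+j ⟨
      N ℕ.+ i          ∎
      where open ≡.≡-Reasoning

    k≤N⇔x₀≤t : k ≤ N ⇔ x₀ ≤ t
    k≤N⇔x₀≤t = mk⇔ (λ k≤N → ℕ.m≤n+o⇒m∸n≤o i j (Equivalence.to (+-cross-≤-⇔ k+[j+t]≡N+i) k≤N))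
                   (λ x₀≤t → Equivalence.from (+-cross-≤-⇔ k+[j+t]≡N+i) (m∸n≤o⇒m≤n+o x₀≤t))

    module OnAntidiagonal (x₀≤t : x₀ ≤ t) where

      l : ℕ
      l = N ∸ k

      l+i≡t+j : l ℕ.+ i ≡ t ℕ.+ j
      l+i≡t+j = ℕ.+-cancelʳ-≡ k _ _ (begin
        l ℕ.+ i ℕ.+ k    ≡⟨ xy∙z≈xz∙y l i k ⟩
        l ℕ.+ k ℕ.+ i    ≡⟨ ≡.cong (ℕ._+ i) (ℕ.m∸n+n≡m (Equivalence.from k≤N⇔x₀≤t x₀≤t)) ⟩
        N ℕ.+ i          ≡⟨ k+[j+t]≡N+i ⟨
        k ℕ.+ (j ℕ.+ t)  ≡⟨ x∙yz≈zy∙x k j t ⟩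
        t ℕ.+ j ℕ.+ k    ∎)
        where open ≡.≡-Reasoning

      l<r⇔t<d : l < r ⇔ t < d
      l<r⇔t<d = +-cross-<-⇔ (begin
        l ℕ.+ (rj ℕ.+ i)  ≡⟨ x∙yz≈xz∙y l rj i ⟩
        l ℕ.+ i ℕ.+ rj    ≡⟨ ≡.cong (ℕ._+ rj) l+i≡t+j ⟩
        t ℕ.+ j ℕ.+ rj    ≡⟨ xy∙z≈zy∙x t j rj ⟩
        rj ℕ.+ j ℕ.+ t    ≡⟨ ≡.cong (ℕ._+ t) (ℕ.m∸n+n≡m j≤r) ⟩
        r ℕ.+ t           ∎)
        where open ≡.≡-Reasoning

      a<l⇔rj≤t : a < l ⇔ rj ≤ t
      a<l⇔rj≤t = mk⇔ (λ a<l → ℕ.≤-pred (Equivalence.to cross a<l)) (λ rj≤t → Equivalence.from cross (s≤s rj≤t))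
        where
        open ≡.≡-Reasoning
        cross : a < l ⇔ rj < suc t
        cross = +-cross-<-⇔ (ℕ.+-cancelʳ-≡ i _ _ (begin
          a ℕ.+ suc t ℕ.+ i    ≡⟨ ≡.trans (≡.cong (ℕ._+ i) (ℕ.+-suc a t)) (≡.cong suc (xy∙z≈xz∙y a t i)) ⟩
          suc (a ℕ.+ i ℕ.+ t)  ≡⟨ ≡.cong (λ m → suc (m ℕ.+ t)) a+i≡D ⟩
          r ℕ.+ t              ≡⟨ ≡.cong (ℕ._+ t) (ℕ.m∸n+n≡m j≤r) ⟨
          rj ℕ.+ j ℕ.+ t       ≡⟨ xy∙z≈x∙zy rj j t ⟩
          rj ℕ.+ (t ℕ.+ j)     ≡⟨ ≡.cong (rj ℕ.+_) l+i≡t+j ⟨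
          rj ℕ.+ (l ℕ.+ i)     ≡⟨ x∙yz≈yx∙z rj l i ⟩
          l ℕ.+ rj ℕ.+ i       ∎))

      r∸l≡d∸t : l ≤ r → r ∸ l ≡ d ∸ t
      r∸l≡d∸t = r∸x≡[r∸j+i]∸y j≤r l+i≡t+j

module ClosedForms {c ℓ : Level} (R : CommutativeRing c ℓ) where

  open CommutativeRing R
  open NatEmbedding R
  open IntegerCoefficients R using (solve; _:=_; _:*_; _:-_)
  open Sums R
  open Indicators R
  open BezoutEntries R
  open import Algebra.Properties.Ring ring using ([y-z]x≈yx-zx)
  open import Relation.Binary.Reasoning.Setoid setoid

  private
    [_≤_<_]′ = [_≤_<_] R

  module Entry (D : ℕ) (rinv : Carrier) (ρ*rinv≈1 : ι R (suc D) * rinv ≈ 1#) (coeff : Fin (suc D) → Carrier)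
               (i j : ℕ) (1≤i : 1 ≤ i) (i≤D : i ≤ D) (1≤j : 1 ≤ j) (j≤D : j ≤ D) where

    open Indices D i j i≤D 1≤j j≤D public
    open Setup R (suc D) coeff
    open WithInv rinv

    ρ : Carrier
    ρ = ι R r

    g : ℕ → Carrier
    g t = ι R (d ∸ t) * ι R (r ∸ t) * (S t * S (d ∸ t))

    P : ℕ → Carrier
    P n = ∑ R 0 n g

    i≤r : i ≤ r
    i≤r = ℕ.m≤n⇒m≤1+n i≤D

    x₀≤rj : x₀ ≤ rj
    x₀≤rj = ℕ.∸-monoˡ-≤ j i≤r

    x₀≤i : x₀ ≤ i
    x₀≤i = ℕ.m∸n≤m i j

    rj≤d : rj ≤ d
    rj≤d = ℕ.m≤m+n rj i

    g-vanishes : ∀ t → r ⊓ d ≤ t → g t ≈ 0#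
    g-vanishes t r⊓d≤t = trans (*-congʳ weight≈0) (zeroˡ _)
      where
      ι-vanishes : ∀ {m} → m ≤ t → ι R (m ∸ t) ≈ 0#
      ι-vanishes m≤t = reflexive (≡.cong (ι R) (ℕ.m≤n⇒m∸n≡0 m≤t))
      weight≈0 : ι R (d ∸ t) * ι R (r ∸ t) ≈ 0#
      weight≈0 with ℕ.⊓-sel r d
      ... | inj₁ r⊓d≡r = trans (*-congˡ (ι-vanishes (≡.subst (_≤ t) r⊓d≡r r⊓d≤t))) (zeroʳ _)
      ... | inj₂ r⊓d≡d = trans (*-congʳ (ι-vanishes (≡.subst (_≤ t) r⊓d≡d r⊓d≤t))) (zeroˡ _)

    Φ : ℕ → Carrier
    Φ k = T₃ i k * T₄ k j - T₁ i k * T₂ k j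

    private
      zero-difference : ∀ {x y} → x ≈ 0# → y ≈ 0# → x - y ≈ 0#
      zero-difference x≈0 y≈0 = trans (+-cong x≈0 (-‿cong y≈0)) (-‿inverseʳ 0#)

    Φ-vanishes : ∀ k → ¬ (i ≤ k × j ≤ k) → Φ k ≈ 0#
    Φ-vanishes k ∉ with i ≤? k | j ≤? k
    ... | yes i≤k | yes j≤k = contradiction (i≤k , j≤k) ∉
    ... | no _    | _       = zero-difference (zeroˡ _) (zeroˡ _)
    ... | yes _   | no _    = zero-difference (zeroʳ _) (zeroʳ _)

    Φ-explicit : ∀ k → i ≤ k → j ≤ k →
      Φ k ≈ S (r ∸ (k ∸ i)) * (ι R (r ∸ (k ∸ j)) * S (k ∸ j)) - ι R (k ∸ i) * S (r ∸ (k ∸ i)) * S (k ∸ j)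
    Φ-explicit k i≤k j≤k with i ≤? k | j ≤? k
    ... | yes _  | yes _  = refl
    ... | no i≰k | _      = contradiction i≤k i≰k
    ... | yes _  | no j≰k = contradiction j≤k j≰k

    -- With e = j + t - i one has d ∸ t = r ∸ e, and r((r - t) - e) = (r - e)(r - t) - t e.
    Φ-shifted : ∀ t → x₀ ≤ t → t < rj → Φ (j ℕ.+ t) ≈ rinv * (g t - g (d ∸ t))
    Φ-shifted t x₀≤t t<rj = begin
      Φ k
        ≈⟨ Φ-explicit k i≤k (ℕ.m≤m+n j t) ⟩
      S (r ∸ e) * (ι R (r ∸ (k ∸ j)) * S (k ∸ j)) - ι R e * S (r ∸ e) * S (k ∸ j)
        ≡⟨ ≡.cong₂ (λ x y → S x * (ι R (r ∸ y) * S y) - ι R e * S x * S y) r∸e≡d∸t (ℕ.m+n∸m≡n j t) ⟩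
      S (d ∸ t) * (ι R (r ∸ t) * S t) - ι R e * S (d ∸ t) * S t
        ≈⟨ +-congʳ (*-congˡ (*-congʳ (ι-∸ t≤r))) ⟩
      S (d ∸ t) * ((ρ - ι R t) * S t) - ι R e * S (d ∸ t) * S t
        ≈⟨ *-identityˡ _ ⟨
      1# * (S (d ∸ t) * ((ρ - ι R t) * S t) - ι R e * S (d ∸ t) * S t)
        ≈⟨ *-congʳ ρ*rinv≈1 ⟨
      ρ * rinv * (S (d ∸ t) * ((ρ - ι R t) * S t) - ι R e * S (d ∸ t) * S t)
        ≈⟨ solve 6 (λ ρ rinv τ ε A B →
                      ρ :* rinv :* (A :* ((ρ :- τ) :* B) :- ε :* A :* B)
                   := rinv :* ((ρ :- ε) :* (ρ :- τ) :* (B :* A) :- τ :* ε :* (A :* B)))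
                 refl ρ rinv (ι R t) (ι R e) (S (d ∸ t)) (S t) ⟩
      rinv * ((ρ - ι R e) * (ρ - ι R t) * (S t * S (d ∸ t)) - ι R t * ι R e * (S (d ∸ t) * S t))
        ≈⟨ *-congˡ (+-cong (*-congʳ (*-cong ιd∸t (ι-∸ t≤r))) (-‿cong (reflexive g-reflected))) ⟨
      rinv * (g t - g (d ∸ t))
        ∎
      where
      k = j ℕ.+ t
      e = k ∸ i
      i≤k : i ≤ k
      i≤k = m∸n≤o⇒m≤n+o x₀≤t
      k<r : k < r
      k<r = ≡.subst (k <_) (ℕ.m+[n∸m]≡n j≤r) (ℕ.+-monoʳ-< j t<rj)
      t≤r : t ≤ r
      t≤r = ℕ.≤-trans (ℕ.m≤n+m t j) (ℕ.<⇒≤ k<r)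
      e≤r : e ≤ r
      e≤r = ℕ.≤-trans (ℕ.m∸n≤m k i) (ℕ.<⇒≤ k<r)
      t≤d : t ≤ d
      t≤d = ℕ.≤-trans (ℕ.<⇒≤ t<rj) rj≤d
      r∸e≡d∸t : r ∸ e ≡ d ∸ t
      r∸e≡d∸t = r∸x≡[r∸j+i]∸y j≤r (≡.trans (ℕ.m∸n+n≡m i≤k) (ℕ.+-comm j t)) e≤r
      ιd∸t : ι R (d ∸ t) ≈ ρ - ι R e
      ιd∸t = trans (reflexive (≡.cong (ι R) (≡.sym r∸e≡d∸t))) (ι-∸ e≤r)
      g-reflected : g (d ∸ t) ≡ ι R t * ι R e * (S (d ∸ t) * S t)
      g-reflected = ≡.cong₂ (λ x y → ι R x * ι R y * (S (d ∸ t) * S x)) (ℕ.m∸[m∸n]≡n t≤d)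
                      (≡.trans (≡.cong (r ∸_) (≡.sym r∸e≡d∸t)) (ℕ.m∸[m∸n]≡n e≤r))

    ∑Φ : ∑ R 1 D Φ ≈ rinv * ((P rj - P x₀) - (P r - P (suc i)))
    ∑Φ = begin
      ∑ R 1 D Φ
        ≈⟨ ∑-from D 1≤K K≤r (λ t _ t<K → Φ-vanishes t (below-K t<K)) ⟩
      ∑ R K (r ∸ K) Φ
        ≡⟨ ≡.cong (λ m → ∑ R K m Φ) (ℕ.∸-+-assoc r j x₀) ⟨
      ∑ R (j ℕ.+ x₀) n Φ
        ≈⟨ ∑-shift j x₀ n Φ ⟩
      ∑ R x₀ n (λ t → Φ (j ℕ.+ t))
        ≈⟨ ∑-cong x₀ n (λ t (x₀≤t , t<) → Φ-shifted t x₀≤t (≡.subst (t <_) x₀+n≡rj t<)) ⟩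
      ∑ R x₀ n (λ t → rinv * (g t - g (d ∸ t)))
        ≈⟨ trans (∑-*ˡ x₀ n rinv _) (*-congˡ (∑-- x₀ n g _)) ⟩
      rinv * (∑ R x₀ n g - ∑ R x₀ n (λ t → g (d ∸ t)))
        ≈⟨ *-congˡ (+-cong (∑-prefixes x₀ n g) (-‿cong (∑-reverse d x₀ n g x₀+n≤1+d))) ⟩
      rinv * ((P (x₀ ℕ.+ n) - P x₀) - ∑ R (suc d ∸ (x₀ ℕ.+ n)) n g)
        ≡⟨ ≡.cong₂ (λ a b → rinv * ((P a - P x₀) - ∑ R b n g)) x₀+n≡rj 1+d∸[x₀+n]≡1+i ⟩
      rinv * ((P rj - P x₀) - ∑ R (suc i) n g)
        ≈⟨ *-congˡ (+-congˡ (-‿cong (∑-prefixes (suc i) n g))) ⟩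
      rinv * ((P rj - P x₀) - (P (suc i ℕ.+ n) - P (suc i)))
        ≈⟨ *-congˡ (+-congˡ (-‿cong (+-congʳ tail))) ⟩
      rinv * ((P rj - P x₀) - (P r - P (suc i)))
        ∎
      where
      K = j ℕ.+ x₀
      n = rj ∸ x₀
      1≤K : 1 ≤ K
      1≤K = ℕ.≤-trans 1≤j (ℕ.m≤m+n j x₀)
      K≤r : K ≤ r
      K≤r = ≡.subst (K ≤_) (ℕ.m+[n∸m]≡n j≤r) (ℕ.+-monoʳ-≤ j x₀≤rj)
      below-K : ∀ {t} → t < K → ¬ (i ≤ t × j ≤ t)
      below-K {t} t<K (i≤t , j≤t) =
        ℕ.<⇒≱ t<K (≡.subst (K ≤_) (ℕ.m+[n∸m]≡n j≤t) (ℕ.+-monoʳ-≤ j (ℕ.∸-monoˡ-≤ j i≤t)))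
      x₀+n≡rj : x₀ ℕ.+ n ≡ rj
      x₀+n≡rj = ℕ.m+[n∸m]≡n x₀≤rj
      x₀+n≤1+d : x₀ ℕ.+ n ≤ suc d
      x₀+n≤1+d = ≡.subst (_≤ suc d) (≡.sym x₀+n≡rj) (ℕ.m≤n⇒m≤1+n rj≤d)
      1+d∸[x₀+n]≡1+i : suc d ∸ (x₀ ℕ.+ n) ≡ suc i
      1+d∸[x₀+n]≡1+i = ≡.trans (≡.cong₂ _∸_ (≡.sym (ℕ.+-suc rj i)) x₀+n≡rj) (ℕ.m+n∸m≡n rj (suc i))
      r⊓d≤1+i+n : r ⊓ d ≤ suc i ℕ.+ n
      r⊓d≤1+i+n = ℕ.m≤n⇒m≤1+n (ℕ.≤-reflexive (≡.sym (i+[[r∸j]∸[i∸j]]≡r⊓[r∸j+i] j≤r i≤r)))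
      tail : P (suc i ℕ.+ n) ≈ P r
      tail = trans (∑-prefix-stable (r ⊓ d) (suc i ℕ.+ n) g g-vanishes r⊓d≤1+i+n)
                   (sym (∑-prefix-stable (r ⊓ d) r g g-vanishes (ℕ.m⊓n≤m r d)))

    uv≈g : u i * v j ≈ g i
    uv≈g = begin
      ι R (r ∸ i) * S i * (ι R rj * S rj)
        ≈⟨ solve 4 (λ a b c e → a :* b :* (c :* e) := c :* a :* (b :* e)) refl (ι R (r ∸ i)) (S i) (ι R rj) (S rj) ⟩
      ι R rj * ι R (r ∸ i) * (S i * S rj)
        ≡⟨ ≡.cong (λ m → ι R m * ι R (r ∸ i) * (S i * S m)) (ℕ.m+n∸n≡m rj i) ⟨
      g i
        ∎

    LHS-closed-form : LHS i j ≈ rinv * ((P rj - P x₀) - (P r - P (suc i))) - rinv * (P (suc i) - P i)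
    LHS-closed-form = begin
      - ∑ R 1 D (λ k → T₁ i k * T₂ k j) + ∑ R 1 D (λ k → T₃ i k * T₄ k j) - rinv * (u i * v j)
        ≈⟨ +-congʳ (trans (+-comm _ _) (sym (∑-- 1 D _ _))) ⟩
      ∑ R 1 D Φ - rinv * (u i * v j)
        ≈⟨ +-cong ∑Φ (-‿cong (*-congˡ (trans uv≈g g-as-prefixes))) ⟩
      rinv * ((P rj - P x₀) - (P r - P (suc i))) - rinv * (P (suc i) - P i)
        ∎
      where
      g-as-prefixes : g i ≈ P (suc i) - P i
      g-as-prefixes = begin
        g i               ≈⟨ +-identityʳ _ ⟨
        g i + 0#          ≈⟨ ∑-prefixes i 1 g ⟩
        P (i ℕ.+ 1) - P i ≡⟨ ≡.cong (λ m → P m - P i) (ℕ.+-comm i 1) ⟩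
        P (suc i) - P i   ∎

    F : Poly R
    F = deriv R f

    f-explicit : ∀ {x} → x ≤ r → f x ≈ S (r ∸ x)
    f-explicit {x} x≤r with x ≤? r
    ... | yes _  = refl
    ... | no x≰r = contradiction x≤r x≰r

    G-explicit : ∀ {l} → l ≤ r → G l ≈ rinv * (ι R (r ∸ l) * S (r ∸ l))
    G-explicit {l} l≤r = begin
      f l - rinv * mulX R F l                    ≈⟨ +-congˡ (-‿cong (*-congˡ (mulX-deriv f l))) ⟩
      f l - rinv * (ι R l * f l)                 ≈⟨ +-congʳ (*-identityˡ _) ⟨
      1# * f l - rinv * (ι R l * f l)            ≈⟨ +-congʳ (*-congʳ ρ*rinv≈1) ⟨
      ρ * rinv * f l - rinv * (ι R l * f l)
        ≈⟨ solve 4 (λ ρ rinv λ′ x → ρ :* rinv :* x :- rinv :* (λ′ :* x) := rinv :* ((ρ :- λ′) :* x))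
                   refl ρ rinv (ι R l) (f l) ⟩
      rinv * ((ρ - ι R l) * f l)                 ≈⟨ *-congˡ (*-cong (sym (ι-∸ l≤r)) (f-explicit l≤r)) ⟩
      rinv * (ι R (r ∸ l) * S (r ∸ l))           ∎

    antidiagonal-summand : ℕ → Carrier
    antidiagonal-summand k = [ N ∸ D ≤ k < suc N ]′ * (F k * G (N ∸ k) * ([ 0 ≤ a < k ]′ - [ 0 ≤ a < N ∸ k ]′))

    χ : ℕ → Carrier
    χ t = [ x₀ ≤ t < i ]′ - [ rj ≤ t < r ]′

    private
      rinv*[0*y]≈0 : ∀ {x y} → x ≈ 0# → rinv * (x * y) ≈ 0#
      rinv*[0*y]≈0 x≈0 = trans (*-congˡ (trans (*-congʳ x≈0) (zeroˡ _))) (zeroʳ rinv)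

      rinv*[x*0]≈0 : ∀ {x y} → y ≈ 0# → rinv * (x * y) ≈ 0#
      rinv*[x*0]≈0 y≈0 = trans (*-congˡ (trans (*-congˡ y≈0) (zeroʳ _))) (zeroʳ rinv)

    -- Row k = D ∸ t meets the antidiagonal iff x₀ ≤ t, in column l = t + j - i, and l ≤ D iff t < d.
    antidiagonal-summand-reflected : ∀ t → t ≤ D → antidiagonal-summand (D ∸ t) ≈ rinv * (χ t * g t)
    antidiagonal-summand-reflected t t≤D = by-cases (x₀ ≤? t) (t <? d)
      where
      open At t t≤D

      by-cases : Dec (x₀ ≤ t) → Dec (t < d) → antidiagonal-summand k ≈ rinv * (χ t * g t)
      by-cases (no x₀≰t) _ = begin
        antidiagonal-summand k   ≈⟨ *-congʳ (indicator-out {N ∸ D} (λ (_ , k<1+N) → x₀≰t (k≤N⇒x₀≤t (ℕ.≤-pred k<1+N)))) ⟩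
        0# * _                   ≈⟨ zeroˡ _ ⟩
        0#                       ≈⟨ rinv*[0*y]≈0 (zero-difference (indicator-below i t<x₀) (indicator-below r t<rj)) ⟨
        rinv * (χ t * g t)       ∎
        where
        k≤N⇒x₀≤t = Equivalence.to k≤N⇔x₀≤t
        t<x₀ = ℕ.≰⇒> x₀≰t
        t<rj = ℕ.<-≤-trans t<x₀ x₀≤rj
      by-cases (yes x₀≤t) (no t≮d) = begin
        antidiagonal-summand k   ≈⟨ *-congʳ (indicator-out (λ (N∸D≤k , _) → t≮d (l<r⇒t<d (s≤s (m∸n≤o⇒m∸o≤n N∸D≤k))))) ⟩
        0# * _                   ≈⟨ zeroˡ _ ⟩
        0#                       ≈⟨ rinv*[x*0]≈0 (g-vanishes t (ℕ.≤-trans (ℕ.m⊓n≤n r d) (ℕ.≮⇒≥ t≮d))) ⟨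
        rinv * (χ t * g t)       ∎
        where
        open OnAntidiagonal x₀≤t
        l<r⇒t<d = Equivalence.to l<r⇔t<d
      by-cases (yes x₀≤t) (yes t<d) = begin
        antidiagonal-summand k
          ≈⟨ *-congʳ (indicator-in (m∸n≤o⇒m∸o≤n l≤D) (s≤s k≤N)) ⟩
        1# * (F k * G l * ([ 0 ≤ a < k ]′ - [ 0 ≤ a < l ]′))
          ≈⟨ *-identityˡ _ ⟩
        F k * G l * ([ 0 ≤ a < k ]′ - [ 0 ≤ a < l ]′)
          ≈⟨ *-cong (*-cong F-explicit G-explicit′) (+-cong lower-indicator (-‿cong upper-indicator)) ⟩
        ι R (r ∸ t) * S t * (rinv * (ι R (d ∸ t) * S (d ∸ t))) * χ t
          ≈⟨ solve 6 (λ rinv A B C E σ → A :* B :* (rinv :* (C :* E)) :* σ := rinv :* (σ :* (C :* A :* (B :* E))))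
                     refl rinv (ι R (r ∸ t)) (S t) (ι R (d ∸ t)) (S (d ∸ t)) (χ t) ⟩
        rinv * (χ t * g t)
          ∎
        where
        open OnAntidiagonal x₀≤t
        k≤N : k ≤ N
        k≤N = Equivalence.from k≤N⇔x₀≤t x₀≤t
        l≤D : l ≤ D
        l≤D = ℕ.≤-pred (Equivalence.from l<r⇔t<d t<d)
        F-explicit : F k ≈ ι R (r ∸ t) * S t
        F-explicit = begin
          ι R (suc k) * f (suc k)          ≈⟨ *-congˡ (f-explicit (s≤s (ℕ.m∸n≤m D t))) ⟩
          ι R (suc k) * S (r ∸ suc k)      ≡⟨ ≡.cong₂ (λ x y → ι R x * S y) (≡.sym r∸t≡1+k) r∸[1+k]≡t ⟩
          ι R (r ∸ t) * S t                ∎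
        G-explicit′ : G l ≈ rinv * (ι R (d ∸ t) * S (d ∸ t))
        G-explicit′ = trans (G-explicit (ℕ.m≤n⇒m≤1+n l≤D))
                            (reflexive (≡.cong (λ x → rinv * (ι R x * S x)) (r∸l≡d∸t (ℕ.m≤n⇒m≤1+n l≤D))))
        lower-indicator : [ 0 ≤ a < k ]′ ≈ [ x₀ ≤ t < i ]′
        lower-indicator = indicator-cong (mk⇔ (λ (_ , a<k) → x₀≤t , Equivalence.to a<k⇔t<i a<k)
                                              (λ (_ , t<i) → z≤n , Equivalence.from a<k⇔t<i t<i))
        upper-indicator : [ 0 ≤ a < l ]′ ≈ [ rj ≤ t < r ]′
        upper-indicator = indicator-cong (mk⇔ (λ (_ , a<l) → Equivalence.to a<l⇔rj≤t a<l , s≤s t≤D)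
                                              (λ (rj≤t , _) → z≤n , Equivalence.from a<l⇔rj≤t rj≤t))

    RHS-closed-form : Bᵣ i j ≈ rinv * ((P i - P x₀) - (P r - P rj))
    RHS-closed-form = begin
      Bᵣ i j
        ≈⟨ J-⊗ D (Bez₁ R D F G) j 1≤i i≤D ⟩
      Bez R D F G a b
        ≈⟨ Bez-antidiagonal D F G a b ⟩
      ∑ R 0 r antidiagonal-summand
        ≡⟨ ≡.cong (λ m → ∑ R m r antidiagonal-summand) (ℕ.n∸n≡0 r) ⟨
      ∑ R (r ∸ r) r antidiagonal-summand
        ≈⟨ ∑-reverse D 0 r antidiagonal-summand ℕ.≤-refl ⟨
      ∑ R 0 r (λ t → antidiagonal-summand (D ∸ t))
        ≈⟨ ∑-cong 0 r (λ t (_ , t<r) → antidiagonal-summand-reflected t (ℕ.≤-pred t<r)) ⟩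
      ∑ R 0 r (λ t → rinv * (χ t * g t))
        ≈⟨ ∑-*ˡ 0 r rinv _ ⟩
      rinv * ∑ R 0 r (λ t → χ t * g t)
        ≈⟨ *-congˡ (trans (∑-cong 0 r (λ t _ → [y-z]x≈yx-zx (g t) _ _)) (∑-- 0 r _ _)) ⟩
      rinv * (∑ R 0 r (λ t → [ x₀ ≤ t < i ]′ * g t) - ∑ R 0 r (λ t → [ rj ≤ t < r ]′ * g t))
        ≈⟨ *-congˡ (+-cong (∑-indicator r g x₀≤i i≤r) (-‿cong (∑-indicator r g (ℕ.m∸n≤m r j) ℕ.≤-refl))) ⟩
      rinv * (∑ R x₀ (i ∸ x₀) g - ∑ R rj (r ∸ rj) g)
        ≈⟨ *-congˡ (+-cong (∑-prefixes x₀ (i ∸ x₀) g) (-‿cong (∑-prefixes rj (r ∸ rj) g))) ⟩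
      rinv * ((P (x₀ ℕ.+ (i ∸ x₀)) - P x₀) - (P (rj ℕ.+ (r ∸ rj)) - P rj))
        ≡⟨ ≡.cong₂ (λ m n → rinv * ((P m - P x₀) - (P n - P rj))) (ℕ.m+[n∸m]≡n x₀≤i) (ℕ.m+[n∸m]≡n (ℕ.m∸n≤m r j)) ⟩
      rinv * ((P i - P x₀) - (P r - P rj))
        ∎

proposition6 : ∀ {c ℓ : Level} (R : CommutativeRing c ℓ) →
    let open CommutativeRing R in
    (r : ℕ) → 2 ≤ r →
    (rinv : Carrier) → ι R r * rinv ≈ 1# →
    (s : Fin r → Carrier) →
    (i j : ℕ) → 1 ≤ i → i ≤ r ∸ 1 → 1 ≤ j → j ≤ r ∸ 1 →
    Setup.WithInv.LHS R r s rinv i j ≈ Setup.WithInv.Bᵣ R r s rinv i j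
proposition6 R (suc D) _ rinv ρ*rinv≈1 s i j 1≤i i≤D 1≤j j≤D = begin
  LHS i j
    ≈⟨ LHS-closed-form ⟩
  rinv * ((P rj - P x₀) - (P r - P (suc i))) - rinv * (P (suc i) - P i)
    ≈⟨ solve 6 (λ rinv Prj Px₀ Pr P1+i Pi →
                  rinv :* ((Prj :- Px₀) :- (Pr :- P1+i)) :- rinv :* (P1+i :- Pi)
               := rinv :* ((Pi :- Px₀) :- (Pr :- Prj)))
             refl rinv (P rj) (P x₀) (P r) (P (suc i)) (P i) ⟩
  rinv * ((P i - P x₀) - (P r - P rj))
    ≈⟨ RHS-closed-form ⟨
  Bᵣ i j
    ∎
  where
  open CommutativeRing R
  open IntegerCoefficients R using (solve; _:=_; _:-_; _:*_)
  open ClosedForms.Entry R D rinv ρ*rinv≈1 s i j 1≤i i≤D 1≤j j≤D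
  open Setup.WithInv R (suc D) s rinv
  open import Relation.Binary.Reasoning.Setoid setoid
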